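{- Let $\mathbf A=\langle A,\to,0\rangle$ be a finite $\mathbf{I}_{2,0}$-chain with $|A|\ge 2$, with its elements labeled as $A=[-n,m]$ so that $-n\sqsubset -n+1\sqsubset\cdots\sqsubset -1\sqsubset 0\sqsubset 1\sqsubset\cdots\sqsubset m$ (the constant being labeled $0$). If $a\in A$ with $0\sqsubset a$, then $a'=p(p(a)')$.
   Context: A zroupoid is an algebra $\langle A,\to,0\rangle$ with binary $\to$ and constant $0$; $x':=x\to 0$. An implication zroupoid satisfies (I) $(x\to y)\to z\approx[(z'\to x)\to(y\to z)']'$ and $0''\approx 0$; $\mathbf{I}_{2,0}$ is the variety of implication zroupoids satisfying $x''\approx x$. For $x,y\in A$, $x\sqsubseteq y$ iff $(x\to y')'=x$; $x\sqsubset y$ means $x\sqsubseteq y$ and $x\ne y$. An $\mathbf{I}_{2,0}$-chain is a member of $\mathbf{I}_{2,0}$ on which $\sqsubseteq$ is a total order. With the labeling $A=[-n,m]$ as in the claim, $p:A\to A$ is defined by $p(x)=x-1$ if $x>-n$ and $p(-n)=-n$ (the predecessor in $\sqsubseteq$). -}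

module Defs where

open import Data.Nat using (ℕ; z≤n)
open import Data.Integer using (ℤ; +_; -_; _≤_; _<_; _<?_; pred; +≤+)
open import Data.Integer.Properties using (i<j⇒i≤pred[j]; i≤j⇒pred[i]≤j; ≤-refl; neg-≤-pos)
open import Data.Product using (_×_)
open import Relation.Binary.PropositionalEquality using (_≡_; _≢_)
open import Relation.Nullary using (yes; no)
open import Function.Bundles using (_⇔_)

-- The carrier [-n, m]: integers k with -n ≤ k ≤ m (bounds irrelevant, so
-- equality of elements is equality of labels).
record Elt (n m : ℕ) : Set where
  constructor elt
  field
    val : ℤ
    .lo : - (+ n) ≤ val
    .hi : val ≤ + m
open Elt public

𝟘 : {n m : ℕ} → Elt n m
𝟘 {n} {m} = elt (+ 0) neg-≤-pos (+≤+ z≤n)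

p : {n m : ℕ} → Elt n m → Elt n m
p {n} {m} (elt k lo hi) with - (+ n) <? k
... | yes lt = elt (pred k) (i<j⇒i≤pred[j] lt) (i≤j⇒pred[i]≤j hi)
... | no _   = elt k lo hi

module Zroupoid {n m : ℕ} (_⇒_ : Elt n m → Elt n m → Elt n m) where

  infix 8 _′
  _′ : Elt n m → Elt n m
  x ′ = x ⇒ 𝟘

  IsImplicationZroupoid : Set
  IsImplicationZroupoid =
    (∀ x y z → ((x ⇒ y) ⇒ z) ≡ ((((z ′) ⇒ x) ⇒ ((y ⇒ z) ′)) ′)) × ((𝟘 ′) ′ ≡ 𝟘)

  IsI20 : Set
  IsI20 = IsImplicationZroupoid × (∀ x → (x ′) ′ ≡ x)

  _⊑_ : Elt n m → Elt n m → Set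
  x ⊑ y = ((x ⇒ (y ′)) ′) ≡ x

  _⊏_ : Elt n m → Elt n m → Set
  x ⊏ y = (x ⊑ y) × (x ≢ y)

  -- the labeling lists the elements in ⊑-order: -n ⊏ -n+1 ⊏ ... ⊏ m,
  -- i.e. ⊑ coincides with the integer order on labels (so ⊑ is total)
  LabelingRespectsOrder : Set
  LabelingRespectsOrder = ∀ x y → (x ⊑ y) ⇔ (val x ≤ val y)

-- (1) Order theory.  Let f be an involution of [-n, m] that maps an
--     upward-closed set P of labels into itself and is antitone on P.
--     Then f is strictly antitone on P, and it sends a covering pair
--     p(a) ⋖ a inside P to a covering pair f(a) ⋖ f(p(a)): no label c can
--     lie strictly between them, since f would place f(c) strictly between
--     p(a) and a.  Hence f(a) = p(f(p(a))).
--
-- (2) Algebra.  In an I_{2,0}-chain whose labeling respects ⊑, the map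
--     x ↦ x′ is an involution, maps the nonnegative labels {x | 0 ⊑ x} to
--     themselves, and is antitone on them.  These follow from a few
--     identities of implication zroupoids (0′ → x = x, x′ → 0′ = 0 → x, …).
--
-- The theorem is (1) applied to f = ′ and P = {x | 0 ≤ x}.
module Submission where

open import Defs
open import Data.Nat using (ℕ; _+_; _≤_)
open import Data.Integer as ℤ using (ℤ; +_; -_; pred)
open import Data.Integer.Properties
  using (≤-refl; ≤-trans; ≤-antisym; ≤-total; ≤-reflexive; <⇒≤; <⇒≢; <⇒≱;
         ≤-<-trans; ≤∧≢⇒<; ≮⇒≥; neg-≤-pos; i<j⇒i≤pred[j];
         i≤pred[j]⇒i<j; _≤?_)
open import Data.Product using (_,_; proj₁; proj₂)
open import Data.Sum using (inj₁; inj₂)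
open import Data.Empty using (⊥; ⊥-elim)
open import Relation.Binary.PropositionalEquality
  using (_≡_; refl; sym; trans; cong; subst; module ≡-Reasoning)
open import Relation.Nullary using (yes; no)
open import Relation.Nullary.Decidable using (recompute)
open import Function.Bundles using (Equivalence)

val-injective : {n m : ℕ} {x y : Elt n m} → val x ≡ val y → x ≡ y
val-injective {x = elt k _ _} {y = elt .k _ _} refl = refl

-- The (irrelevant) lower bound of a label, recovered as a usable proof.
lower-bound : {n m : ℕ} (x : Elt n m) → - (+ n) ℤ.≤ val x
lower-bound {n} (elt k bottom≤k _) = recompute (- (+ n) ≤? k) bottom≤k

val-p : {n m : ℕ} (x : Elt n m) → - (+ n) ℤ.< val x → val (p x) ≡ pred (val x)
val-p {n} (elt k _ _) bottom<k with - (+ n) ℤ.<? k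
... | yes _         = refl
... | no  bottom≮k = ⊥-elim (bottom≮k bottom<k)

nothing-between-pred : {i j : ℤ} → pred j ℤ.< i → i ℤ.< j → ⊥
nothing-between-pred pj<i i<j = <⇒≱ pj<i (i<j⇒i≤pred[j] i<j)

module AntitoneInvolution {n m : ℕ} (f : Elt n m → Elt n m)
  (P : Elt n m → Set)
  (involutive : ∀ x → f (f x) ≡ x)
  (upward : ∀ {x y} → P x → val x ℤ.≤ val y → P y)
  (preserves : ∀ {x} → P x → P (f x))
  (antitone : ∀ {x y} → P x → val x ℤ.≤ val y → val (f y) ℤ.≤ val (f x))
  where

  injective : ∀ {x y} → f x ≡ f y → x ≡ y
  injective {x} {y} fx≡fy = begin
    x         ≡⟨ sym (involutive x) ⟩
    f (f x)   ≡⟨ cong f fx≡fy ⟩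
    f (f y)   ≡⟨ involutive y ⟩
    y         ∎
    where open ≡-Reasoning

  -- Being injective, f is strictly antitone on P.
  strictly-antitone : ∀ {x y} → P x → val x ℤ.< val y → val (f y) ℤ.< val (f x)
  strictly-antitone Px x<y =
    ≤∧≢⇒< (antitone Px (<⇒≤ x<y))
          (λ fy≡fx → <⇒≢ x<y (cong val (injective (val-injective (sym fy≡fx)))))

  reverses-covers : (a : Elt n m) → - (+ n) ℤ.< val a → P (p a) →
                    f a ≡ p (f (p a))
  reverses-covers a bottom<a Pb = val-injective (≤-antisym fa≤c c≤fa)
    where
      b c : Elt n m
      b = p a
      c = p (f b)
      b≡pred-a : val b ≡ pred (val a)
      b≡pred-a = val-p a bottom<a
      b<a : val b ℤ.< val a
      b<a = i≤pred[j]⇒i<j (≤-reflexive b≡pred-a)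
      Pa : P a
      Pa = upward Pb (<⇒≤ b<a)
      fa<fb : val (f a) ℤ.< val (f b)
      fa<fb = strictly-antitone Pb b<a
      c≡pred-fb : val c ≡ pred (val (f b))
      c≡pred-fb = val-p (f b) (≤-<-trans (lower-bound (f a)) fa<fb)
      fa≤c : val (f a) ℤ.≤ val c
      fa≤c = subst (val (f a) ℤ.≤_) (sym c≡pred-fb) (i<j⇒i≤pred[j] fa<fb)
      c<fb : val c ℤ.< val (f b)
      c<fb = i≤pred[j]⇒i<j (≤-reflexive c≡pred-fb)
      -- If f(a) < c < f(b), then p(a) < f(c) < a, which is impossible.
      c≤fa : val c ℤ.≤ val (f a)
      c≤fa = ≮⇒≥ λ fa<c →
        let Pc   = upward (preserves Pa) (<⇒≤ fa<c)
            fc<a = subst (λ x → val (f c) ℤ.< val x) (involutive a)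
                         (strictly-antitone (preserves Pa) fa<c)
            b<fc = subst (λ x → val x ℤ.< val (f c)) (involutive b)
                         (strictly-antitone Pc c<fb)
        in nothing-between-pred (subst (ℤ._< val (f c)) b≡pred-a b<fc) fc<a

module I20Chain {n m : ℕ} (_⇒_ : Elt n m → Elt n m → Elt n m)
  (isI20 : Zroupoid.IsI20 _⇒_) (ordered : Zroupoid.LabelingRespectsOrder _⇒_)
  where
  open Zroupoid _⇒_

  identity-I : ∀ x y z → ((x ⇒ y) ⇒ z) ≡ ((((z ′) ⇒ x) ⇒ ((y ⇒ z) ′)) ′)
  identity-I = proj₁ (proj₁ isI20)

  involutive : ∀ x → (x ′) ′ ≡ x
  involutive = proj₂ isI20

  prime-swap : ∀ {x y} → x ′ ≡ y → x ≡ y ′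
  prime-swap {x} x′≡y = trans (sym (involutive x)) (cong _′ x′≡y)

  ≤⇒arrow : ∀ {x y} → val x ℤ.≤ val y → x ⇒ (y ′) ≡ x ′
  ≤⇒arrow {x} {y} x≤y = prime-swap (Equivalence.from (ordered x y) x≤y)

  arrow⇒≤ : ∀ {x y} → x ⇒ (y ′) ≡ x ′ → val x ℤ.≤ val y
  arrow⇒≤ {x} {y} eq =
    Equivalence.to (ordered x y) (trans (cong _′ eq) (involutive x))

  𝟘′-identity : ∀ x → (𝟘 ′) ⇒ x ≡ x
  𝟘′-identity x = begin
    (𝟘 ′) ⇒ x                          ≡⟨ sym (involutive _) ⟩
    (((𝟘 ′) ⇒ x) ⇒ 𝟘) ′                ≡⟨ cong (λ w → (((𝟘 ′) ⇒ x) ⇒ w) ′) (sym (involutive 𝟘)) ⟩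
    (((𝟘 ′) ⇒ x) ⇒ ((𝟘 ⇒ 𝟘) ′)) ′      ≡⟨ sym (identity-I x 𝟘 𝟘) ⟩
    (x ⇒ 𝟘) ⇒ 𝟘                        ≡⟨ involutive x ⟩
    x                                  ∎
    where open ≡-Reasoning

  𝟘-arrow-left : ∀ y z → (𝟘 ⇒ y) ⇒ z ≡ (z ⇒ ((y ⇒ z) ′)) ′
  𝟘-arrow-left y z =
    trans (identity-I 𝟘 y z) (cong (λ w → (w ⇒ ((y ⇒ z) ′)) ′) (involutive z))

  𝟘-arrow-𝟘′ : 𝟘 ⇒ (𝟘 ′) ≡ 𝟘 ′
  𝟘-arrow-𝟘′ = begin
    𝟘 ⇒ (𝟘 ′)                                 ≡⟨ sym (involutive _) ⟩
    ((𝟘 ⇒ (𝟘 ′)) ′) ′                         ≡⟨ cong _′ (sym (𝟘′-identity _)) ⟩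
    ((𝟘 ′) ⇒ ((𝟘 ⇒ (𝟘 ′)) ′)) ′               ≡⟨ cong (λ w → (w ⇒ ((𝟘 ⇒ (𝟘 ′)) ′)) ′) (sym (involutive _)) ⟩
    ((((𝟘 ′) ′) ⇒ 𝟘) ⇒ ((𝟘 ⇒ (𝟘 ′)) ′)) ′     ≡⟨ sym (identity-I 𝟘 𝟘 (𝟘 ′)) ⟩
    (𝟘 ⇒ 𝟘) ⇒ (𝟘 ′)                           ≡⟨ 𝟘′-identity _ ⟩
    𝟘 ′                                       ∎
    where open ≡-Reasoning

  prime-arrow-𝟘′ : ∀ x → (x ′) ⇒ (𝟘 ′) ≡ 𝟘 ⇒ x
  prime-arrow-𝟘′ x = begin
    (x ⇒ 𝟘) ⇒ (𝟘 ′)                          ≡⟨ identity-I x 𝟘 (𝟘 ′) ⟩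
    ((((𝟘 ′) ′) ⇒ x) ⇒ ((𝟘 ⇒ (𝟘 ′)) ′)) ′    ≡⟨ cong (λ w → ((w ⇒ x) ⇒ ((𝟘 ⇒ (𝟘 ′)) ′)) ′) (involutive 𝟘) ⟩
    ((𝟘 ⇒ x) ⇒ ((𝟘 ⇒ (𝟘 ′)) ′)) ′            ≡⟨ cong (λ w → ((𝟘 ⇒ x) ⇒ (w ′)) ′) 𝟘-arrow-𝟘′ ⟩
    ((𝟘 ⇒ x) ⇒ ((𝟘 ′) ′)) ′                  ≡⟨ cong (λ w → ((𝟘 ⇒ x) ⇒ w) ′) (involutive 𝟘) ⟩
    ((𝟘 ⇒ x) ⇒ 𝟘) ′                          ≡⟨ involutive _ ⟩
    𝟘 ⇒ x                                    ∎
    where open ≡-Reasoning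

  arrow-𝟘′-twice : ∀ x → (x ⇒ (𝟘 ′)) ⇒ (𝟘 ′) ≡ 𝟘 ⇒ x
  arrow-𝟘′-twice x = begin
    (x ⇒ (𝟘 ′)) ⇒ (𝟘 ′)                              ≡⟨ identity-I x (𝟘 ′) (𝟘 ′) ⟩
    ((((𝟘 ′) ′) ⇒ x) ⇒ (((𝟘 ′) ⇒ (𝟘 ′)) ′)) ′       ≡⟨ cong (λ w → ((w ⇒ x) ⇒ (((𝟘 ′) ⇒ (𝟘 ′)) ′)) ′) (involutive 𝟘) ⟩
    ((𝟘 ⇒ x) ⇒ (((𝟘 ′) ⇒ (𝟘 ′)) ′)) ′               ≡⟨ cong (λ w → ((𝟘 ⇒ x) ⇒ (w ′)) ′) (𝟘′-identity _) ⟩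
    ((𝟘 ⇒ x) ⇒ ((𝟘 ′) ′)) ′                          ≡⟨ cong (λ w → ((𝟘 ⇒ x) ⇒ w) ′) (involutive 𝟘) ⟩
    ((𝟘 ⇒ x) ⇒ 𝟘) ′                                  ≡⟨ involutive _ ⟩
    𝟘 ⇒ x                                            ∎
    where open ≡-Reasoning

  Nonneg : Elt n m → Set
  Nonneg x = + 0 ℤ.≤ val x

  -- Prime maps nonnegative labels to nonnegative labels: if 0 ≤ x and
  -- x′ ≤ 0, then x = 0′, so x′ = 0 after all.
  prime-nonneg : ∀ {x} → Nonneg x → Nonneg (x ′)
  prime-nonneg {x} 0≤x with ≤-total (+ 0) (val (x ′))
  ... | inj₁ 0≤x′ = 0≤x′
  ... | inj₂ x′≤0 = subst (λ w → Nonneg (w ′)) (sym x≡𝟘′)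
                          (subst Nonneg (sym (involutive 𝟘)) ≤-refl)
    where
      𝟘-arrow-x : 𝟘 ⇒ x ≡ x
      𝟘-arrow-x = trans (sym (prime-arrow-𝟘′ x)) (trans (≤⇒arrow x′≤0) (involutive x))
      x-arrow-𝟘′ : x ⇒ (𝟘 ′) ≡ 𝟘 ′
      x-arrow-𝟘′ = trans (cong (_⇒ (𝟘 ′)) (sym (involutive x)))
                         (trans (prime-arrow-𝟘′ (x ′)) (≤⇒arrow 0≤x))
      x≡𝟘′ : x ≡ 𝟘 ′
      x≡𝟘′ = begin
        x                      ≡⟨ sym 𝟘-arrow-x ⟩
        𝟘 ⇒ x                  ≡⟨ sym (arrow-𝟘′-twice x) ⟩
        (x ⇒ (𝟘 ′)) ⇒ (𝟘 ′)    ≡⟨ cong (_⇒ (𝟘 ′)) x-arrow-𝟘′ ⟩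
        (𝟘 ′) ⇒ (𝟘 ′)          ≡⟨ 𝟘′-identity _ ⟩
        𝟘 ′                    ∎
        where open ≡-Reasoning

  -- Prime is antitone on nonnegative labels: if 0 ≤ x ≤ y and x′ ≤ y′,
  -- then y ⊑ x, so x = y.
  prime-antitone : ∀ {x y} → Nonneg x → val x ℤ.≤ val y → val (y ′) ℤ.≤ val (x ′)
  prime-antitone {x} {y} 0≤x x≤y with ≤-total (val (y ′)) (val (x ′))
  ... | inj₁ y′≤x′ = y′≤x′
  ... | inj₂ x′≤y′ = subst (λ w → val (w ′) ℤ.≤ val (x ′)) x≡y ≤-refl
    where
      x′-arrow-y : (x ′) ⇒ y ≡ x
      x′-arrow-y = begin
        (x ′) ⇒ y              ≡⟨ cong ((x ′) ⇒_) (sym (involutive y)) ⟩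
        (x ′) ⇒ ((y ′) ′)      ≡⟨ ≤⇒arrow x′≤y′ ⟩
        (x ′) ′                ≡⟨ involutive x ⟩
        x                      ∎
        where open ≡-Reasoning
      y-arrow-x′ : y ⇒ (x ′) ≡ y ′
      y-arrow-x′ = begin
        y ⇒ (x ′)                       ≡⟨ sym (involutive _) ⟩
        ((y ⇒ (x ′)) ′) ′               ≡⟨ cong (λ w → ((y ⇒ (w ′)) ′) ′) (sym x′-arrow-y) ⟩
        ((y ⇒ (((x ′) ⇒ y) ′)) ′) ′     ≡⟨ cong _′ (sym (𝟘-arrow-left (x ′) y)) ⟩
        ((𝟘 ⇒ (x ′)) ⇒ y) ′             ≡⟨ cong (λ w → (w ⇒ y) ′) (≤⇒arrow 0≤x) ⟩
        ((𝟘 ′) ⇒ y) ′                   ≡⟨ cong _′ (𝟘′-identity y) ⟩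
        y ′                             ∎
        where open ≡-Reasoning
      x≡y : x ≡ y
      x≡y = val-injective (≤-antisym x≤y (arrow⇒≤ y-arrow-x′))

  open AntitoneInvolution _′ Nonneg involutive ≤-trans
                          prime-nonneg prime-antitone
    public using (reverses-covers)

lemma5p11 : (n m : ℕ) (_⇒_ : Elt n m → Elt n m → Elt n m) →
    Zroupoid.IsI20 _⇒_ →
    Zroupoid.LabelingRespectsOrder _⇒_ →
    1 ≤ n + m →
    (a : Elt n m) → Zroupoid._⊏_ _⇒_ 𝟘 a →
    Zroupoid._′ _⇒_ a ≡ p (Zroupoid._′ _⇒_ (p a))
lemma5p11 n m _⇒_ isI20 ordered _ a (𝟘⊑a , 𝟘≢a) =
  reverses-covers a bottom<a 0≤pa
  where
    open I20Chain _⇒_ isI20 ordered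
    0<a : + 0 ℤ.< val a
    0<a = ≤∧≢⇒< (arrow⇒≤ (prime-swap 𝟘⊑a)) (λ 0≡a → 𝟘≢a (val-injective 0≡a))
    bottom<a : - (+ n) ℤ.< val a
    bottom<a = ≤-<-trans neg-≤-pos 0<a
    0≤pa : Nonneg (p a)
    0≤pa = subst (+ 0 ℤ.≤_) (sym (val-p a bottom<a)) (i<j⇒i≤pred[j] 0<a)
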